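{- Let $H$ be a Heyting algebra, let $n \geq 1$ and let $f_{1},\ldots,f_{n}$ be monotone polynomials on $H$ each having a least fixed point $\mu_x.f_i(x)$. Then the function $x\mapsto\bigwedge_{i=1}^{n} f_{i}(x)$ has a least fixed point, and $\mu_{x}.\bigwedge_{i=1}^{n} f_{i}(x) = \bigwedge_{i=1}^{n} \mu_{x}.f_{i}(x)$.
   Context: A function $f : H \to H$ on a Heyting algebra $H$ is a polynomial if there exist an IPC formula $\phi$, a variable $x$, and a valuation $v$ in $H$ of the variables of $\phi$ other than $x$ such that $f(h) = [\![\phi]\!]_{(v,h/x)}$ for all $h\in H$. Least fixed points are understood as least prefixed points (elements $p$ with $f(p)\le p$), which are fixed points. -}

module Defs where

open import Level using (Level)
open import Data.Nat using (ℕ; suc)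
open import Data.Fin using (Fin; zero; suc)
open import Data.Product using (Σ; ∃; _×_)
open import Relation.Binary.Lattice.Bundles using (HeytingAlgebra)
open import Relation.Nullary using (Dec; yes; no)
open import Data.Nat using (_≟_)

data Formula : Set where
  var  : ℕ → Formula
  ⊥f   : Formula
  ⊤f   : Formula
  _∧f_ : Formula → Formula → Formula
  _∨f_ : Formula → Formula → Formula
  _⇒f_ : Formula → Formula → Formula

module _ {c ℓ₁ ℓ₂ : Level} (H : HeytingAlgebra c ℓ₁ ℓ₂) where
  open HeytingAlgebra H

  ⟦_⟧ : Formula → (ℕ → Carrier) → Carrier
  ⟦ var k ⟧ v = v k
  ⟦ ⊥f ⟧ v = ⊥
  ⟦ ⊤f ⟧ v = ⊤
  ⟦ φ ∧f ψ ⟧ v = ⟦ φ ⟧ v ∧ ⟦ ψ ⟧ v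
  ⟦ φ ∨f ψ ⟧ v = ⟦ φ ⟧ v ∨ ⟦ ψ ⟧ v
  ⟦ φ ⇒f ψ ⟧ v = ⟦ φ ⟧ v ⇨ ⟦ ψ ⟧ v

  _[_↦_] : (ℕ → Carrier) → ℕ → Carrier → (ℕ → Carrier)
  (v [ x ↦ h ]) k with k ≟ x
  ... | yes _ = h
  ... | no  _ = v k

  IsPolynomial : (Carrier → Carrier) → Set (c Level.⊔ ℓ₁)
  IsPolynomial f = Σ Formula λ φ → Σ ℕ λ x → Σ (ℕ → Carrier) λ v →
    ∀ h → f h ≈ ⟦ φ ⟧ (v [ x ↦ h ])

  Monotone : (Carrier → Carrier) → Set (c Level.⊔ ℓ₂)
  Monotone f = ∀ {a b} → a ≤ b → f a ≤ f b

  -- least fixed point, understood as least prefixed point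
  IsLeastFixedPoint : (Carrier → Carrier) → Carrier → Set (c Level.⊔ ℓ₂)
  IsLeastFixedPoint f p = (f p ≤ p) × (∀ q → f q ≤ q → p ≤ q)

  HasLeastFixedPoint : (Carrier → Carrier) → Set (c Level.⊔ ℓ₂)
  HasLeastFixedPoint f = Σ Carrier (IsLeastFixedPoint f)

  ⋀₁ : ∀ n → (Fin (suc n) → Carrier) → Carrier
  ⋀₁ ℕ.zero a = a zero
  ⋀₁ (suc n) a = a zero ∧ ⋀₁ n (λ i → a (suc i))

{-# OPTIONS --safe #-}
module Submission where

-- Polynomials on a Heyting algebra are compatible: a ∧ x = a ∧ y implies
-- a ∧ f x = a ∧ f y (each connective, ⇨ included, preserves this).  For a
-- compatible f with least fixed point μ, whenever f q ∧ a ≤ q the element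
-- a ⇨ q is a prefixed point of f, so μ ∧ a ≤ q.  Given a prefixed point q
-- of f ∧ g, this first yields ν ∧ f q ≤ q (for g, with a = f q) and then
-- μ ∧ ν ≤ q (for f, with a = ν); thus μ ∧ ν is the least fixed point of
-- f ∧ g, and induction on n handles finite meets.

open import Defs
open import Level using (Level)
open import Data.Nat using (ℕ; zero; suc; _≟_)
open import Data.Fin using (Fin; zero; suc)
open import Data.Product using (Σ; _×_; _,_)
open import Function using (_∘_)
open import Relation.Binary.Lattice.Bundles using (HeytingAlgebra)
open import Relation.Nullary using (yes; no)

module _ {c ℓ₁ ℓ₂ : Level} (H : HeytingAlgebra c ℓ₁ ℓ₂) where
  open HeytingAlgebra H
  open import Relation.Binary.Lattice.Properties.MeetSemilattice meetSemilattice
    using (∧-comm; ∧-monotonic)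
  open import Relation.Binary.Lattice.Properties.JoinSemilattice joinSemilattice
    using (∨-monotonic)
  open import Relation.Binary.Lattice.Properties.HeytingAlgebra H
    using (⇨-eval; y≤x⇨y; ∧-distribˡ-∨-≤)
  open import Relation.Binary.Reasoning.PartialOrder poset

  -- The usual notion (a ∧ x = a ∧ y ⇒ a ∧ f x = a ∧ f y), stated with inequalities.
  Compatible : (Carrier → Carrier) → Set (c Level.⊔ ℓ₂)
  Compatible f = ∀ {a x y} → a ∧ x ≤ y → a ∧ y ≤ x → a ∧ f x ≤ f y

  const-compatible : ∀ b → Compatible (λ _ → b)
  const-compatible b _ _ = x∧y≤y _ b

  id-compatible : Compatible (λ x → x)
  id-compatible a∧x≤y _ = a∧x≤y

  ∧-compatible : ∀ {f g} → Compatible f → Compatible g → Compatible (λ x → f x ∧ g x)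
  ∧-compatible f-compat g-compat {a} a∧x≤y a∧y≤x = ∧-greatest
    (trans (∧-monotonic refl (x∧y≤x _ _)) (f-compat a∧x≤y a∧y≤x))
    (trans (∧-monotonic refl (x∧y≤y _ _)) (g-compat a∧x≤y a∧y≤x))

  ∨-compatible : ∀ {f g} → Compatible f → Compatible g → Compatible (λ x → f x ∨ g x)
  ∨-compatible {f} {g} f-compat g-compat {a} {x} {y} a∧x≤y a∧y≤x = begin
    a ∧ (f x ∨ g x)        ≤⟨ ∧-distribˡ-∨-≤ a (f x) (g x) ⟩
    a ∧ f x ∨ a ∧ g x      ≤⟨ ∨-monotonic (f-compat a∧x≤y a∧y≤x) (g-compat a∧x≤y a∧y≤x) ⟩
    f y ∨ g y              ∎

  ⇨-compatible : ∀ {f g} → Compatible f → Compatible g → Compatible (λ x → f x ⇨ g x)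
  ⇨-compatible {f} {g} f-compat g-compat {a} {x} {y} a∧x≤y a∧y≤x =
    transpose-⇨ (begin
      (a ∧ (f x ⇨ g x)) ∧ f y        ≤⟨ ∧-greatest (trans (x∧y≤x _ _) (x∧y≤x _ _)) f-holds ⟩
      a ∧ g x                        ≤⟨ g-compat a∧x≤y a∧y≤x ⟩
      g y                            ∎)
    where
    -- the premise f y is transported back to f x, where the implication fires
    f-holds : (a ∧ (f x ⇨ g x)) ∧ f y ≤ g x
    f-holds = begin
      (a ∧ (f x ⇨ g x)) ∧ f y        ≤⟨ ∧-greatest (trans (x∧y≤x _ _) (x∧y≤y _ _))
                                          (∧-monotonic (x∧y≤x _ _) refl) ⟩
      (f x ⇨ g x) ∧ (a ∧ f y)        ≤⟨ ∧-monotonic refl (f-compat a∧y≤x a∧x≤y) ⟩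
      (f x ⇨ g x) ∧ f x              ≤⟨ ⇨-eval ⟩
      g x                            ∎

  polynomial : Formula → ℕ → (ℕ → Carrier) → Carrier → Carrier
  polynomial φ x v h = ⟦ H ⟧ φ (_[_↦_] H v x h)

  polynomial-compatible : ∀ φ x v → Compatible (polynomial φ x v)
  polynomial-compatible (var k) x v with k ≟ x
  ... | yes _ = id-compatible
  ... | no _  = const-compatible (v k)
  polynomial-compatible ⊥f x v = const-compatible ⊥
  polynomial-compatible ⊤f x v = const-compatible ⊤
  polynomial-compatible (φ ∧f ψ) x v =
    ∧-compatible (polynomial-compatible φ x v) (polynomial-compatible ψ x v)
  polynomial-compatible (φ ∨f ψ) x v =
    ∨-compatible (polynomial-compatible φ x v) (polynomial-compatible ψ x v)
  polynomial-compatible (φ ⇒f ψ) x v =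
    ⇨-compatible (polynomial-compatible φ x v) (polynomial-compatible ψ x v)

  isPolynomial⇒compatible : ∀ {f} → IsPolynomial H f → Compatible f
  isPolynomial⇒compatible {f} (φ , x , v , f≈φ) {a} {y} {z} a∧y≤z a∧z≤y = begin
    a ∧ f y                  ≤⟨ ∧-monotonic refl (reflexive (f≈φ y)) ⟩
    a ∧ polynomial φ x v y   ≤⟨ polynomial-compatible φ x v a∧y≤z a∧z≤y ⟩
    polynomial φ x v z       ≤⟨ reflexive (Eq.sym (f≈φ z)) ⟩
    f z                      ∎

  lfp-relative-induction : ∀ {f μ} → Compatible f → IsLeastFixedPoint H f μ →
                           ∀ {a q} → f q ∧ a ≤ q → μ ∧ a ≤ q
  lfp-relative-induction {f} f-compat (_ , μ-least) {a} {q} fq∧a≤q =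
    transpose-∧ (μ-least (a ⇨ q) (transpose-⇨ (begin
      f (a ⇨ q) ∧ a            ≤⟨ ∧-greatest (trans (reflexive (∧-comm _ _)) f[a⇨q]) (x∧y≤y _ _) ⟩
      f q ∧ a                  ≤⟨ fq∧a≤q ⟩
      q                        ∎)))
    where
    f[a⇨q] : a ∧ f (a ⇨ q) ≤ f q
    f[a⇨q] = f-compat (trans (reflexive (∧-comm _ _)) ⇨-eval) (trans (x∧y≤y _ _) y≤x⇨y)

  ∧-lfp : ∀ {f g μ ν} → Compatible f → Compatible g → Monotone H f → Monotone H g →
          IsLeastFixedPoint H f μ → IsLeastFixedPoint H g ν →
          IsLeastFixedPoint H (λ x → f x ∧ g x) (μ ∧ ν)
  ∧-lfp {f} {g} {μ} {ν} f-compat g-compat f-mono g-mono f-lfp@(fμ≤μ , _) g-lfp@(gν≤ν , _) =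
    prefixed , least
    where
    prefixed : f (μ ∧ ν) ∧ g (μ ∧ ν) ≤ μ ∧ ν
    prefixed = ∧-monotonic (trans (f-mono (x∧y≤x _ _)) fμ≤μ) (trans (g-mono (x∧y≤y _ _)) gν≤ν)

    least : ∀ q → f q ∧ g q ≤ q → μ ∧ ν ≤ q
    least q fq∧gq≤q = lfp-relative-induction f-compat f-lfp
      (trans (reflexive (∧-comm _ _)) ν∧fq≤q)
      where
      ν∧fq≤q : ν ∧ f q ≤ q
      ν∧fq≤q = lfp-relative-induction g-compat g-lfp (trans (reflexive (∧-comm _ _)) fq∧gq≤q)

  ⋀₁-compatible : ∀ m {f : Fin (suc m) → Carrier → Carrier} → (∀ i → Compatible (f i)) →
                  Compatible (λ x → ⋀₁ H m (λ i → f i x))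
  ⋀₁-compatible zero    compat = compat zero
  ⋀₁-compatible (suc m) compat = ∧-compatible (compat zero) (⋀₁-compatible m (compat ∘ suc))

  ⋀₁-monotone : ∀ m {f : Fin (suc m) → Carrier → Carrier} → (∀ i → Monotone H (f i)) →
                Monotone H (λ x → ⋀₁ H m (λ i → f i x))
  ⋀₁-monotone zero    mono = mono zero
  ⋀₁-monotone (suc m) mono x≤y = ∧-monotonic (mono zero x≤y) (⋀₁-monotone m (mono ∘ suc) x≤y)

  ⋀₁-lfp : ∀ m {f : Fin (suc m) → Carrier → Carrier} {μ : Fin (suc m) → Carrier} →
           (∀ i → Compatible (f i)) → (∀ i → Monotone H (f i)) →
           (∀ i → IsLeastFixedPoint H (f i) (μ i)) →
           IsLeastFixedPoint H (λ x → ⋀₁ H m (λ i → f i x)) (⋀₁ H m μ)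
  ⋀₁-lfp zero    compat mono lfp = lfp zero
  ⋀₁-lfp (suc m) compat mono lfp =
    ∧-lfp (compat zero) (⋀₁-compatible m (compat ∘ suc))
          (mono zero) (⋀₁-monotone m (mono ∘ suc))
          (lfp zero) (⋀₁-lfp m (compat ∘ suc) (mono ∘ suc) (lfp ∘ suc))

corollary3p6 : ∀ {c ℓ₁ ℓ₂ : Level} (H : HeytingAlgebra c ℓ₁ ℓ₂) (m : ℕ)
    (f : Fin (suc m) → HeytingAlgebra.Carrier H → HeytingAlgebra.Carrier H)
    → (∀ i → IsPolynomial H (f i))
    → (∀ i → Monotone H (f i))
    → (μ : Fin (suc m) → HeytingAlgebra.Carrier H)
    → (∀ i → IsLeastFixedPoint H (f i) (μ i))
    → Σ (HeytingAlgebra.Carrier H) λ p →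
        IsLeastFixedPoint H (λ x → ⋀₁ H m (λ i → f i x)) p
        × HeytingAlgebra._≈_ H p (⋀₁ H m μ)
corollary3p6 H m f isPolynomial monotone μ lfp =
  ⋀₁ H m μ ,
  ⋀₁-lfp H m (λ i → isPolynomial⇒compatible H (isPolynomial i)) monotone lfp ,
  HeytingAlgebra.Eq.refl H
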